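{- Let $\mathbf A=\langle A,\to,0\rangle$ be a finite $\mathbf{I}_{2,0}$-chain. Then $\mathbf A\cong\langle[-n,m];\Rightarrow,0\rangle$ for some integers $n,m$ with $0\le n,m\le |A|-1$ and $n+m+1=|A|$.
   Context: A zroupoid is an algebra $\langle A,\to,0\rangle$ with binary $\to$ and constant $0$; $x':=x\to 0$. An implication zroupoid satisfies (I) $(x\to y)\to z\approx[(z'\to x)\to(y\to z)']'$ and $0''\approx 0$; $\mathbf{I}_{2,0}$ is the variety of implication zroupoids satisfying $x''\approx x$. Define $x\sqsubseteq y$ iff $(x\to y')'=x$; an $\mathbf{I}_{2,0}$-chain is a member of $\mathbf{I}_{2,0}$ on which $\sqsubseteq$ is total. Construction: for integers $n,m\ge 0$ let $[-n,m]=\{x\in\mathbb Z:-n\le x\le m\}$ with the usual order $\le$. Define $p:[-n,m]\to[-n,m]$ by $p(x)=x-1$ if $x>-n$ and $p(-n)=-n$. Define $x^\ast$ recursively by $0^\ast=m$, $x^\ast=x$ if $x<0$, and $x^\ast=p\big((p(x))^\ast\big)$ if $x>0$. Define $x\Rightarrow y=\max(x^\ast,y)$ if $x,y\ge 0$, and $x\Rightarrow y=\min(x,y)$ otherwise; the constant is $0\in[-n,m]$. -}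

module Defs where

open import Data.Nat as ℕ using (ℕ; zero; suc)
open import Data.Integer as ℤ using (ℤ; +_; -[1+_]; -_; pred; _⊔_; _⊓_; _≤_; _<_; _≤?_; _<?_; 0ℤ; +≤+)
open import Data.Integer.Properties as ℤP
open import Data.Product using (_×_; _,_)
open import Data.Sum using (_⊎_)
open import Relation.Binary.PropositionalEquality using (_≡_)
open import Relation.Nullary using (yes; no)

record Zroupoid : Set₁ where
  infixr 5 _⇒_
  field
    Carrier : Set
    _⇒_     : Carrier → Carrier → Carrier
    𝟎       : Carrier

  _′ : Carrier → Carrier
  x ′ = x ⇒ 𝟎

  _⊑_ : Carrier → Carrier → Set
  x ⊑ y = ((x ⇒ (y ′)) ′) ≡ x


IsImplicationZroupoid : Zroupoid → Set
IsImplicationZroupoid A =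
  (∀ x y z → ((x ⇒ y) ⇒ z) ≡ (((z ′) ⇒ x) ⇒ ((y ⇒ z) ′)) ′)
  × ((𝟎 ′) ′ ≡ 𝟎)
  where open Zroupoid A

IsI20 : Zroupoid → Set
IsI20 A = IsImplicationZroupoid A × (∀ x → (x ′) ′ ≡ x)
  where open Zroupoid A

IsI20Chain : Zroupoid → Set
IsI20Chain A = IsI20 A × (∀ x y → (x ⊑ y) ⊎ (y ⊑ x))
  where open Zroupoid A

module Model (n m : ℕ) where

  p : ℤ → ℤ
  p x with (- (+ n)) <? x
  ... | yes _ = pred x
  ... | no  _ = - (+ n)

  -- x* : 0* = m, x* = x for x < 0, x* = p((p x)*) for x > 0
  -- (for x = k+1 > 0 we have p x = k since x > 0 ≥ -n; hence (k+1)* = p(k*))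
  star : ℤ → ℤ
  star (+ zero)   = + m
  star (+ suc k)  = p (star (+ k))
  star -[1+ k ]   = -[1+ k ]

  imp : ℤ → ℤ → ℤ
  imp x y with 0ℤ ≤? x | 0ℤ ≤? y
  ... | yes _ | yes _ = star x ⊔ y
  ... | yes _ | no  _ = x ⊓ y
  ... | no  _ | _     = x ⊓ y

  record Elt : Set where
    constructor ⟨_,_,_⟩
    field
      val : ℤ
      lo  : - (+ n) ≤ val
      hi  : val ≤ + m
  open Elt public

  p-lo : ∀ x → - (+ n) ≤ p x
  p-lo x with (- (+ n)) <? x
  ... | yes lt = i<j⇒i≤pred[j] lt
  ... | no  _  = ≤-refl

  p-hi : ∀ x → x ≤ + m → p x ≤ + m
  p-hi x h with (- (+ n)) <? x
  ... | yes _ = i≤j⇒pred[i]≤j h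
  ... | no  _ = ≤-trans (neg-≤-pos {n} {0}) (+≤+ ℕ.z≤n)

  star-lo : ∀ k → - (+ n) ≤ star (+ k)
  star-lo zero    = ≤-trans (neg-≤-pos {n} {0}) (+≤+ ℕ.z≤n)
  star-lo (suc k) = p-lo (star (+ k))

  star-hi : ∀ k → star (+ k) ≤ + m
  star-hi zero    = ≤-refl
  star-hi (suc k) = p-hi (star (+ k)) (star-hi k)

  star-lo′ : ∀ x → 0ℤ ≤ x → - (+ n) ≤ star x
  star-lo′ (+ k) _ = star-lo k

  star-hi′ : ∀ x → 0ℤ ≤ x → star x ≤ + m
  star-hi′ (+ k) _ = star-hi k

  imp-lo : ∀ x y → - (+ n) ≤ x → - (+ n) ≤ y → - (+ n) ≤ imp x y
  imp-lo x y hx hy with 0ℤ ≤? x | 0ℤ ≤? y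
  ... | yes px | yes _ = ≤-trans (star-lo′ x px) (i≤i⊔j (star x) y)
  ... | yes _  | no  _ = ⊓-glb hx hy
  ... | no  _  | _     = ⊓-glb hx hy

  imp-hi : ∀ x y → x ≤ + m → y ≤ + m → imp x y ≤ + m
  imp-hi x y hx hy with 0ℤ ≤? x | 0ℤ ≤? y
  ... | yes px | yes _ = ⊔-lub (star-hi′ x px) hy
  ... | yes _  | no  _ = ≤-trans (i⊓j≤i x y) hx
  ... | no  _  | _     = ≤-trans (i⊓j≤i x y) hx

  _⇛_ : Elt → Elt → Elt
  a ⇛ b = ⟨ imp (val a) (val b)
          , imp-lo (val a) (val b) (lo a) (lo b)
          , imp-hi (val a) (val b) (hi a) (hi b) ⟩

  zeroElt : Elt
  zeroElt = ⟨ 0ℤ , neg-≤-pos {n} {0} , +≤+ ℕ.z≤n ⟩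

  algebra : Zroupoid
  algebra = record { Carrier = Elt ; _⇒_ = _⇛_ ; 𝟎 = zeroElt }

Interval : ℕ → ℕ → Zroupoid
Interval n m = Model.algebra n m

record _≅_ (A B : Zroupoid) : Set where
  private
    module A = Zroupoid A
    module B = Zroupoid B
  field
    to      : A.Carrier → B.Carrier
    from    : B.Carrier → A.Carrier
    from∘to : ∀ x → from (to x) ≡ x
    to∘from : ∀ y → to (from y) ≡ y
    to-⇒    : ∀ x y → to (x A.⇒ y) ≡ (to x) B.⇒ (to y)
    to-𝟎    : to A.𝟎 ≡ B.𝟎

module Submission where

-- Write x ∧ y := (x → y')'.  Then x ⊑ y means x ∧ y = x, and identity (I)
-- together with x'' = x and totality of ⊑ make ⊑ a total order whose
-- meet is ∧ (ChainAlgebra).  Negation fixes the elements strictly below 0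
-- and reverses the order on the elements above 0.  Since
-- x → y = (x ∧ y')', the operation is determined by the order and by ′.
--
-- For a finite strict total order, the rank of a (the number of elements
-- below a) is an order isomorphism onto {0,…,k-1} (Counting, Rank).  With
-- n = rank 0 and m = the number of elements above 0, the map
-- a ↦ rank a - n is a bijection onto [-n,m] preserving meets; a counting
-- argument along the involution ′ shows rank(a') = n + #{c | a < c} for
-- a ≥ 0, i.e. it sends ′ to the negation of the model.  As the model's
-- operation satisfies the same formula x ⇒ y = (min(x, y'))'
-- (IntervalArithmetic), the map is an isomorphism (FiniteChain).

open import Defs

open import Level using (0ℓ)
open import Data.Bool.Base using (if_then_else_)
import Data.Nat.Base as ℕ
import Data.Nat.Properties as ℕ
open import Data.Fin.Base using (Fin; zero; suc; toℕ; fromℕ<; punchOut)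
import Data.Fin.Properties as Fin
open import Data.Fin.Permutation using (permutation)
open import Data.Product.Base using (Σ-syntax; ∃; _×_; _,_; proj₁; proj₂)
open import Data.Sum.Base using (_⊎_; inj₁; inj₂; [_,_])
open import Data.Empty using (⊥-elim)
open import Function.Base using (_∘_)
open import Function.Bundles using (_↔_; Inverse)
open import Relation.Nullary using (¬_; Dec; does; yes; no)
open import Relation.Binary.Core using (Rel)
open import Relation.Binary.Structures using (IsTotalOrder; IsStrictTotalOrder)
open import Relation.Binary.Definitions using (Tri; tri<; tri≈; tri>; DecidableEquality)
import Relation.Binary.Construct.NonStrictToStrict as NonStrictToStrict
open import Relation.Binary.PropositionalEquality
  using (_≡_; refl; sym; trans; cong; cong₂; subst; subst₂; isEquivalence; module ≡-Reasoning)

-- Identity (I) becomes the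
-- distributive law (a ∨ b) ∧ c = (c ∧ a) ∨ (b ∧ c); with involutivity and
-- totality it makes ∧ commutative and selective and ⊑ a total order.
module ChainAlgebra (A : Zroupoid) (chain : IsI20Chain A) where
  open Zroupoid A
  open ≡-Reasoning

  identity-I : ∀ x y z → ((x ⇒ y) ⇒ z) ≡ (((z ′) ⇒ x) ⇒ ((y ⇒ z) ′)) ′
  identity-I = proj₁ (proj₁ (proj₁ chain))

  ′-involutive : ∀ x → x ′ ′ ≡ x
  ′-involutive = proj₂ (proj₁ chain)

  ⊑-total : ∀ x y → x ⊑ y ⊎ y ⊑ x
  ⊑-total = proj₂ chain

  ′-injective : ∀ {x y} → x ′ ≡ y ′ → x ≡ y
  ′-injective {x} {y} eq = begin
    x      ≡⟨ ′-involutive x ⟨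
    x ′ ′  ≡⟨ cong _′ eq ⟩
    y ′ ′  ≡⟨ ′-involutive y ⟩
    y      ∎

  infixl 7 _∧_
  infixl 6 _∨_

  _∧_ : Carrier → Carrier → Carrier
  x ∧ y = (x ⇒ y ′) ′

  _∨_ : Carrier → Carrier → Carrier
  x ∨ y = x ′ ⇒ y

  𝟏 : Carrier
  𝟏 = 𝟎 ′

  ⇒-via-∧ : ∀ x y → x ⇒ y ≡ (x ∧ y ′) ′
  ⇒-via-∧ x y = begin
    x ⇒ y            ≡⟨ cong (x ⇒_) (′-involutive y) ⟨
    x ⇒ y ′ ′        ≡⟨ ′-involutive (x ⇒ y ′ ′) ⟨
    (x ∧ y ′) ′      ∎

  ∧-distrib : ∀ a b c → (a ∨ b) ∧ c ≡ (c ∧ a) ∨ (b ∧ c)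
  ∧-distrib a b c = begin
    ((a ′ ⇒ b) ⇒ c ′) ′                     ≡⟨ cong _′ (identity-I (a ′) b (c ′)) ⟩
    ((c ′ ′ ⇒ a ′) ⇒ (b ⇒ c ′) ′) ′ ′        ≡⟨ ′-involutive _ ⟩
    (c ′ ′ ⇒ a ′) ⇒ (b ∧ c)                 ≡⟨ cong (λ t → (t ⇒ a ′) ⇒ (b ∧ c)) (′-involutive c) ⟩
    (c ⇒ a ′) ⇒ (b ∧ c)                     ≡⟨ cong (_⇒ (b ∧ c)) (′-involutive (c ⇒ a ′)) ⟨
    (c ∧ a) ∨ (b ∧ c)                       ∎

  ∧-𝟏 : ∀ a → a ∧ 𝟏 ≡ a
  ∧-𝟏 a = trans (cong (λ t → (a ⇒ t) ′) (′-involutive 𝟎)) (′-involutive a)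

  ∨-𝟎 : ∀ a → a ∨ 𝟎 ≡ a
  ∨-𝟎 = ′-involutive

  𝟏-∧ : ∀ a → 𝟏 ∧ a ≡ a
  𝟏-∧ a = begin
    𝟏 ∧ a                  ≡⟨ ∨-𝟎 (𝟏 ∧ a) ⟨
    (𝟏 ∧ a) ∨ 𝟎            ≡⟨ cong ((𝟏 ∧ a) ∨_) (∧-𝟏 𝟎) ⟨
    (𝟏 ∧ a) ∨ (𝟎 ∧ 𝟏)      ≡⟨ ∧-distrib a 𝟎 𝟏 ⟨
    (a ∨ 𝟎) ∧ 𝟏            ≡⟨ ∧-𝟏 (a ∨ 𝟎) ⟩
    a ∨ 𝟎                  ≡⟨ ∨-𝟎 a ⟩
    a                      ∎

  ∧-idem : ∀ a → a ∧ a ≡ a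
  ∧-idem a with ⊑-total a a
  ... | inj₁ a⊑a = a⊑a
  ... | inj₂ a⊑a = a⊑a

  -- y ∧ x depends on y only through x ∧ y
  ∧-swap : ∀ x y → y ∧ x ≡ (x ∧ y) ∨ (𝟎 ∧ x)
  ∧-swap x y = trans (cong (_∧ x) (sym (∨-𝟎 y))) (∧-distrib y 𝟎 x)

  ∧-comm-below : ∀ {x y} → x ⊑ y → y ∧ x ≡ x
  ∧-comm-below {x} {y} x⊑y = begin
    y ∧ x                ≡⟨ ∧-swap x y ⟩
    (x ∧ y) ∨ (𝟎 ∧ x)    ≡⟨ cong (_∨ (𝟎 ∧ x)) (trans x⊑y (sym (∧-idem x))) ⟩
    (x ∧ x) ∨ (𝟎 ∧ x)    ≡⟨ ∧-swap x x ⟨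
    x ∧ x                ≡⟨ ∧-idem x ⟩
    x                    ∎

  ∧-comm : ∀ x y → x ∧ y ≡ y ∧ x
  ∧-comm x y with ⊑-total x y
  ... | inj₁ x⊑y = trans x⊑y (sym (∧-comm-below x⊑y))
  ... | inj₂ y⊑x = trans (∧-comm-below y⊑x) (sym y⊑x)

  ∧-selective : ∀ x y → x ∧ y ≡ x ⊎ x ∧ y ≡ y
  ∧-selective x y with ⊑-total x y
  ... | inj₁ x⊑y = inj₁ x⊑y
  ... | inj₂ y⊑x = inj₂ (trans (∧-comm x y) y⊑x)

  ∨-via-∧ : ∀ x y → x ∨ y ≡ (x ′ ∧ y ′) ′
  ∨-via-∧ x y = ⇒-via-∧ (x ′) y

  ∨-comm : ∀ x y → x ∨ y ≡ y ∨ x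
  ∨-comm x y = trans (∨-via-∧ x y) (trans (cong _′ (∧-comm (x ′) (y ′))) (sym (∨-via-∧ y x)))

  ∨-selective : ∀ x y → x ∨ y ≡ x ⊎ x ∨ y ≡ y
  ∨-selective x y with ∧-selective (x ′) (y ′)
  ... | inj₁ eq = inj₁ (trans (∨-via-∧ x y) (trans (cong _′ eq) (′-involutive x)))
  ... | inj₂ eq = inj₂ (trans (∨-via-∧ x y) (trans (cong _′ eq) (′-involutive y)))

  ∧-distribʳ : ∀ a b c → (a ∨ b) ∧ c ≡ (a ∧ c) ∨ (b ∧ c)
  ∧-distribʳ a b c = trans (∧-distrib a b c) (cong (_∨ (b ∧ c)) (∧-comm c a))

  ⊑-antisym : ∀ {x y} → x ⊑ y → y ⊑ x → x ≡ y
  ⊑-antisym {x} {y} x⊑y y⊑x = trans (sym x⊑y) (trans (∧-comm x y) y⊑x)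

  -- A cycle x ⊑ y ⊑ z ⊑ x collapses; each step rewrites an element as a
  -- join and distributes the meet over it.
  cycle-collapse-∨ : ∀ {x y z} → x ⊑ y → y ⊑ z → z ⊑ x → x ∨ y ≡ x → y ≡ x
  cycle-collapse-∨ {x} {y} {z} x⊑y y⊑z z⊑x x∨y≡x = begin
    y                  ≡⟨ z∧y≡y ⟨
    z ∧ y              ≡⟨ cong (_∧ y) z≡x∨z ⟩
    (x ∨ z) ∧ y        ≡⟨ ∧-distribʳ x z y ⟩
    (x ∧ y) ∨ (z ∧ y)  ≡⟨ cong₂ _∨_ x⊑y z∧y≡y ⟩
    x ∨ y              ≡⟨ x∨y≡x ⟩
    x                  ∎
    where
    x∧z≡z : x ∧ z ≡ z
    x∧z≡z = trans (∧-comm x z) z⊑x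
    z∧y≡y : z ∧ y ≡ y
    z∧y≡y = trans (∧-comm z y) y⊑z
    y∨z≡z : y ∨ z ≡ z
    y∨z≡z = trans (∨-comm y z) (sym (begin
      z                  ≡⟨ x∧z≡z ⟨
      x ∧ z              ≡⟨ cong (_∧ z) x∨y≡x ⟨
      (x ∨ y) ∧ z        ≡⟨ ∧-distribʳ x y z ⟩
      (x ∧ z) ∨ (y ∧ z)  ≡⟨ cong₂ _∨_ x∧z≡z y⊑z ⟩
      z ∨ y              ∎))
    z≡x∨z : z ≡ x ∨ z
    z≡x∨z = begin
      z                  ≡⟨ z⊑x ⟨
      z ∧ x              ≡⟨ cong (_∧ x) y∨z≡z ⟨
      (y ∨ z) ∧ x        ≡⟨ ∧-distribʳ y z x ⟩
      (y ∧ x) ∨ (z ∧ x)  ≡⟨ cong₂ _∨_ (trans (∧-comm y x) x⊑y) z⊑x ⟩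
      x ∨ z              ∎

  cycle-collapse : ∀ {x y z} → x ⊑ y → y ⊑ z → z ⊑ x → x ≡ y
  cycle-collapse {x} {y} {z} x⊑y y⊑z z⊑x with ∨-selective x y
  ... | inj₁ x∨y≡x = sym (cycle-collapse-∨ x⊑y y⊑z z⊑x x∨y≡x)
  ... | inj₂ x∨y≡y = ⊑-antisym x⊑y y⊑x
    where
    y∨z≡y : y ∨ z ≡ y
    y∨z≡y = trans (∨-comm y z) (sym (begin
      y                  ≡⟨ y⊑z ⟨
      y ∧ z              ≡⟨ cong (_∧ z) x∨y≡y ⟨
      (x ∨ y) ∧ z        ≡⟨ ∧-distribʳ x y z ⟩
      (x ∧ z) ∨ (y ∧ z)  ≡⟨ cong₂ _∨_ (trans (∧-comm x z) z⊑x) y⊑z ⟩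
      z ∨ y              ∎))
    y⊑x : y ⊑ x
    y⊑x = subst (_⊑ x) (cycle-collapse-∨ y⊑z z⊑x x⊑y y∨z≡y) z⊑x

  ⊑-trans : ∀ {x y z} → x ⊑ y → y ⊑ z → x ⊑ z
  ⊑-trans {x} {y} {z} x⊑y y⊑z with ∧-selective x z
  ... | inj₁ x⊑z   = x⊑z
  ... | inj₂ x∧z≡z = subst (_⊑ z) (sym (cycle-collapse x⊑y y⊑z z⊑x)) y⊑z
    where
    z⊑x : z ⊑ x
    z⊑x = trans (∧-comm z x) x∧z≡z

  ⊑-isTotalOrder : IsTotalOrder _≡_ _⊑_
  ⊑-isTotalOrder = record
    { isPartialOrder = record
      { isPreorder = record
        { isEquivalence = isEquivalence
        ; reflexive     = λ { {x} refl → ∧-idem x }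
        ; trans         = ⊑-trans
        }
      ; antisym = ⊑-antisym
      }
    ; total = ⊑-total
    }

  ∨-𝟏 : ∀ a → a ∨ 𝟏 ≡ (a ′ ∧ 𝟎) ′
  ∨-𝟏 a = sym (′-involutive (a ′ ⇒ 𝟎 ′))

  ∨-𝟏-∧ : ∀ a c → (a ∨ 𝟏) ∧ c ≡ (a ∧ c) ∨ c
  ∨-𝟏-∧ a c = trans (∧-distribʳ a 𝟏 c) (cong ((a ∧ c) ∨_) (𝟏-∧ c))

  below-𝟎 : ∀ {a} → a ⊑ 𝟎 → a ′ ≡ a ⊎ a ≡ 𝟎
  below-𝟎 {a} a⊑𝟎 with ∧-selective (a ′) 𝟎
  ... | inj₂ a′∧𝟎≡𝟎 = inj₂ (begin
    a                ≡⟨ ∨-𝟎 a ⟨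
    a ∨ 𝟎            ≡⟨ cong (_∨ 𝟎) a⊑𝟎 ⟨
    (a ∧ 𝟎) ∨ 𝟎      ≡⟨ ∨-𝟏-∧ a 𝟎 ⟨
    (a ∨ 𝟏) ∧ 𝟎      ≡⟨ cong (_∧ 𝟎) (trans (∨-𝟏 a) (cong _′ a′∧𝟎≡𝟎)) ⟩
    𝟏 ∧ 𝟎            ≡⟨ 𝟏-∧ 𝟎 ⟩
    𝟎                ∎)
  ... | inj₁ a′∧𝟎≡a′ with ∧-selective a (a ′)
  ...   | inj₁ a∧a′≡a = inj₁ (sym (begin
    a                  ≡⟨ a∧a′≡a ⟨
    a ∧ a ′            ≡⟨ cong (_∧ a ′) a∨𝟏≡a ⟨
    (a ∨ 𝟏) ∧ a ′      ≡⟨ ∨-𝟏-∧ a (a ′) ⟩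
    (a ∧ a ′) ∨ a ′    ≡⟨ cong (_∨ a ′) a∧a′≡a ⟩
    a ∨ a ′            ≡⟨ ∨-via-∧ a (a ′) ⟩
    (a ′ ∧ a ′ ′) ′    ≡⟨ cong (λ t → (a ′ ∧ t) ′) (′-involutive a) ⟩
    (a ′ ∧ a) ′        ≡⟨ cong _′ (∧-comm (a ′) a) ⟩
    (a ∧ a ′) ′        ≡⟨ cong _′ a∧a′≡a ⟩
    a ′                ∎))
    where
    a∨𝟏≡a : a ∨ 𝟏 ≡ a
    a∨𝟏≡a = trans (∨-𝟏 a) (trans (cong _′ a′∧𝟎≡a′) (′-involutive a))
  ...   | inj₂ a∧a′≡a′ = inj₁ (begin
    a ′                ≡⟨ trans (∧-comm (a ′) a) a∧a′≡a′ ⟨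
    a ′ ∧ a            ≡⟨ cong (_∧ a) a′∨𝟏≡a′ ⟨
    (a ′ ∨ 𝟏) ∧ a      ≡⟨ ∨-𝟏-∧ (a ′) a ⟩
    (a ′ ∧ a) ∨ a      ≡⟨ cong (_∨ a) (trans (∧-comm (a ′) a) a∧a′≡a′) ⟩
    a ′ ′ ⇒ a          ≡⟨ cong (_⇒ a) (′-involutive a) ⟩
    a ⇒ a              ≡⟨ ⇒-via-∧ a a ⟩
    (a ∧ a ′) ′        ≡⟨ cong _′ a∧a′≡a′ ⟩
    a ′ ′              ≡⟨ ′-involutive a ⟩
    a                  ∎)
    where
    a′∨𝟏≡a′ : a ′ ∨ 𝟏 ≡ a ′
    a′∨𝟏≡a′ = trans (∨-𝟏 (a ′)) (cong _′ (trans (cong (_∧ 𝟎) (′-involutive a)) a⊑𝟎))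

  𝟎⊑-′ : ∀ {a} → 𝟎 ⊑ a → 𝟎 ⊑ (a ′)
  𝟎⊑-′ {a} 𝟎⊑a with ∧-selective 𝟎 (a ′)
  ... | inj₁ 𝟎⊑a′ = 𝟎⊑a′
  ... | inj₂ 𝟎∧a′≡a′ with below-𝟎 (trans (∧-comm (a ′) 𝟎) 𝟎∧a′≡a′)
  ...   | inj₁ a′′≡a′ = subst (λ t → 𝟎 ⊑ t) (trans (sym (′-involutive a)) a′′≡a′) 𝟎⊑a
  ...   | inj₂ a′≡𝟎  = subst (λ t → 𝟎 ⊑ t) (sym a′≡𝟎) (∧-idem 𝟎)

  ′-reflects : ∀ {u v} → 𝟎 ⊑ u → u ⊑ v → (u ′) ⊑ (v ′) → u ≡ v
  ′-reflects {u} {v} 𝟎⊑u u⊑v u′⊑v′ = sym (begin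
    v               ≡⟨ 𝟏-∧ v ⟨
    𝟏 ∧ v           ≡⟨ cong (_∧ v) u∨𝟏≡𝟏 ⟨
    (u ∨ 𝟏) ∧ v     ≡⟨ ∨-𝟏-∧ u v ⟩
    (u ∧ v) ∨ v     ≡⟨ cong (_∨ v) u⊑v ⟩
    u ∨ v           ≡⟨ ∨-via-∧ u v ⟩
    (u ′ ∧ v ′) ′   ≡⟨ cong _′ u′⊑v′ ⟩
    u ′ ′           ≡⟨ ′-involutive u ⟩
    u               ∎)
    where
    u∨𝟏≡𝟏 : u ∨ 𝟏 ≡ 𝟏
    u∨𝟏≡𝟏 = trans (∨-𝟏 u) (cong _′ (trans (∧-comm (u ′) 𝟎) (𝟎⊑-′ 𝟎⊑u)))

  ′-antitone : ∀ {a c} → 𝟎 ⊑ a → a ⊑ c → (c ′) ⊑ (a ′)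
  ′-antitone {a} {c} 𝟎⊑a a⊑c with ⊑-total (c ′) (a ′)
  ... | inj₁ c′⊑a′ = c′⊑a′
  ... | inj₂ a′⊑c′ = subst (λ t → (c ′) ⊑ (t ′)) (sym (′-reflects 𝟎⊑a a⊑c a′⊑c′)) (∧-idem (c ′))

module Counting where
  open import Data.Nat.Base using (ℕ; zero; suc; _+_; _≤_; _<_; z≤n; s≤s)
  open import Data.Nat.Properties
    using (+-0-commutativeMonoid; +-mono-≤; +-mono-<-≤; +-mono-≤-<; ≤-reflexive; 1+n≰n)
  open import Algebra.Properties.CommutativeMonoid.Sum +-0-commutativeMonoid
    using (sum; sum-cong-≗; ∑-distrib-+; sum-permute; sum-replicate-zero)

  χ : {P : Set} → Dec P → ℕ
  χ d = if does d then 1 else 0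

  χ-yes : {P : Set} (d : Dec P) → P → χ d ≡ 1
  χ-yes (yes _) _ = refl
  χ-yes (no ¬p) p = ⊥-elim (¬p p)

  χ-no : {P : Set} (d : Dec P) → ¬ P → χ d ≡ 0
  χ-no (yes p) ¬p = ⊥-elim (¬p p)
  χ-no (no _)  _  = refl

  χ-mono : {P Q : Set} (p : Dec P) (q : Dec Q) → (P → Q) → χ p ≤ χ q
  χ-mono (yes a) q f = ≤-reflexive (sym (χ-yes q (f a)))
  χ-mono (no _)  q f = z≤n

  χ-cong : {P Q : Set} (p : Dec P) (q : Dec Q) → (P → Q) → (Q → P) → χ p ≡ χ q
  χ-cong (yes a) q f g = sym (χ-yes q (f a))
  χ-cong (no ¬a) q f g = sym (χ-no q (¬a ∘ g))

  χ-⊎ : {P Q R : Set} (p : Dec P) (q : Dec Q) (r : Dec R) →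
        (P → Q ⊎ R) → (Q ⊎ R → P) → (Q → ¬ R) → χ p ≡ χ q + χ r
  χ-⊎ p (yes a) r f g disjoint =
    trans (χ-yes p (g (inj₁ a))) (cong suc (sym (χ-no r (disjoint a))))
  χ-⊎ p (no ¬a) (yes b) f g disjoint = χ-yes p (g (inj₂ b))
  χ-⊎ p (no ¬a) (no ¬b) f g disjoint = χ-no p λ x → [ ¬a , ¬b ] (f x)

  ∑-one : ∀ k → sum {k} (λ _ → 1) ≡ k
  ∑-one zero    = refl
  ∑-one (suc k) = cong suc (∑-one k)

  ∑-point : ∀ {k} (j : Fin k) → sum (λ i → χ (i Fin.≟ j)) ≡ 1
  ∑-point {suc k} zero    = cong suc (sum-replicate-zero k)
  ∑-point {suc k} (suc j) = ∑-point j

  ∑-mono-≤ : ∀ {k} {f g : Fin k → ℕ} → (∀ i → f i ≤ g i) → sum f ≤ sum g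
  ∑-mono-≤ {zero}  f≤g = z≤n
  ∑-mono-≤ {suc k} f≤g = +-mono-≤ (f≤g zero) (∑-mono-≤ (f≤g ∘ suc))

  ∑-mono-< : ∀ {k} {f g : Fin k → ℕ} → (∀ i → f i ≤ g i) → ∀ j → f j < g j → sum f < sum g
  ∑-mono-< f≤g zero    fj<gj = +-mono-<-≤ fj<gj (∑-mono-≤ (f≤g ∘ suc))
  ∑-mono-< f≤g (suc j) fj<gj = +-mono-≤-< (f≤g zero) (∑-mono-< (f≤g ∘ suc) j fj<gj)

  Fin-injective⇒surjective : ∀ {k} (f : Fin k → Fin k) → (∀ {x y} → f x ≡ f y → x ≡ y) →
                             ∀ j → ∃ λ i → f i ≡ j
  Fin-injective⇒surjective {suc k} f f-inj j with Fin.any? (λ i → f i Fin.≟ j)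
  ... | yes hit = hit
  ... | no miss = ⊥-elim (1+n≰n (Fin.injective⇒≤ {f = f-avoiding-j} f-avoiding-j-inj))
    where
    j≢f : ∀ i → ¬ (j ≡ f i)
    j≢f i j≡fi = miss (i , sym j≡fi)
    -- f misses j, so it squeezes Fin (suc k) into Fin k
    f-avoiding-j : Fin (suc k) → Fin k
    f-avoiding-j i = punchOut (j≢f i)
    f-avoiding-j-inj : ∀ {x y} → f-avoiding-j x ≡ f-avoiding-j y → x ≡ y
    f-avoiding-j-inj eq = f-inj (Fin.punchOut-injective (j≢f _) (j≢f _) eq)

  module Totals {C : Set} {k : ℕ} (enum : C ↔ Fin k) where
    open Inverse enum using (to; from; strictlyInverseˡ; strictlyInverseʳ)

    total : (C → ℕ) → ℕ
    total f = sum (f ∘ from)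

    total-cong : ∀ {f g : C → ℕ} → (∀ c → f c ≡ g c) → total f ≡ total g
    total-cong f≗g = sum-cong-≗ (f≗g ∘ from)

    total-+ : ∀ (f g : C → ℕ) → total (λ c → f c + g c) ≡ total f + total g
    total-+ f g = ∑-distrib-+ (f ∘ from) (g ∘ from)

    total-one : total (λ _ → 1) ≡ k
    total-one = ∑-one k

    total-point : (_≟_ : DecidableEquality C) → ∀ a → total (λ c → χ (c ≟ a)) ≡ 1
    total-point _≟_ a = trans (sum-cong-≗ same) (∑-point (to a))
      where
      same : ∀ i → χ (from i ≟ a) ≡ χ (i Fin.≟ to a)
      same i = χ-cong (from i ≟ a) (i Fin.≟ to a)
        (λ eq → trans (sym (strictlyInverseˡ i)) (cong to eq))
        (λ eq → trans (cong from eq) (strictlyInverseʳ a))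

    total-mono-< : ∀ {f g : C → ℕ} → (∀ c → f c ≤ g c) → ∀ a → f a < g a → total f < total g
    total-mono-< {f} {g} f≤g a fa<ga = ∑-mono-< (f≤g ∘ from) (to a)
      (subst (λ c → f c < g c) (sym (strictlyInverseʳ a)) fa<ga)

    total-involution : ∀ (σ : C → C) → (∀ c → σ (σ c) ≡ c) → ∀ f → total (f ∘ σ) ≡ total f
    total-involution σ σσ f = begin
      sum (f ∘ σ ∘ from)      ≡⟨ sum-cong-≗ (λ i → cong f (strictlyInverseʳ (σ (from i)))) ⟨
      sum (f ∘ from ∘ ρ)      ≡⟨ sum-permute (f ∘ from) (permutation ρ ρ ρρ ρρ) ⟨
      sum (f ∘ from)          ∎
      where
      open ≡-Reasoning
      ρ : Fin k → Fin k
      ρ = to ∘ σ ∘ from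
      ρρ : ∀ i → ρ (ρ i) ≡ i
      ρρ i = trans (cong (to ∘ σ) (strictlyInverseʳ (σ (from i))))
                   (trans (cong to (σσ (from i))) (strictlyInverseˡ i))


module Rank {C : Set} {k : ℕ.ℕ} (enum : C ↔ Fin k)
            {_<ᶜ_ : Rel C 0ℓ} (order : IsStrictTotalOrder _≡_ _<ᶜ_) where
  open import Data.Nat.Base using (ℕ; suc; _+_; _<_; z≤n; s≤s)
  open import Data.Nat.Properties using (<-irrefl; m<m+n)
  open IsStrictTotalOrder order using (compare; _<?_; _≟_)
    renaming (trans to <ᶜ-trans; irrefl to <ᶜ-irrefl)
  open Counting
  open Counting.Totals enum

  rank : C → ℕ
  rank a = total (λ c → χ (c <? a))

  corank : C → ℕ
  corank a = total (λ c → χ (a <? c))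

  trichotomy-χ : ∀ a c → χ (c <? a) + (χ (c ≟ a) + χ (a <? c)) ≡ 1
  trichotomy-χ a c = by-cases (compare c a)
    where
    by-cases : Tri (c <ᶜ a) (c ≡ a) (a <ᶜ c) → χ (c <? a) + (χ (c ≟ a) + χ (a <? c)) ≡ 1
    by-cases (tri< c<a c≢a a≮c) =
      cong₂ _+_ (χ-yes (c <? a) c<a) (cong₂ _+_ (χ-no (c ≟ a) c≢a) (χ-no (a <? c) a≮c))
    by-cases (tri≈ c≮a c≡a a≮c) =
      cong₂ _+_ (χ-no (c <? a) c≮a) (cong₂ _+_ (χ-yes (c ≟ a) c≡a) (χ-no (a <? c) a≮c))
    by-cases (tri> c≮a c≢a a<c) =
      cong₂ _+_ (χ-no (c <? a) c≮a) (cong₂ _+_ (χ-no (c ≟ a) c≢a) (χ-yes (a <? c) a<c))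

  rank+corank : ∀ a → rank a + suc (corank a) ≡ k
  rank+corank a = begin
    rank a + suc (corank a)
      ≡⟨ cong (λ t → rank a + (t + corank a)) (total-point _≟_ a) ⟨
    rank a + (total (λ c → χ (c ≟ a)) + corank a)
      ≡⟨ cong (rank a +_) (total-+ (λ c → χ (c ≟ a)) (λ c → χ (a <? c))) ⟨
    rank a + total (λ c → χ (c ≟ a) + χ (a <? c))
      ≡⟨ total-+ (λ c → χ (c <? a)) (λ c → χ (c ≟ a) + χ (a <? c)) ⟨
    total (λ c → χ (c <? a) + (χ (c ≟ a) + χ (a <? c)))
      ≡⟨ total-cong (trichotomy-χ a) ⟩
    total (λ _ → 1)
      ≡⟨ total-one ⟩
    k ∎
    where open ≡-Reasoning

  rank<k : ∀ a → rank a < k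
  rank<k a = subst (rank a <_) (rank+corank a) (m<m+n (rank a) (s≤s z≤n))

  rank-mono : ∀ {a b} → a <ᶜ b → rank a < rank b
  rank-mono {a} {b} a<b = total-mono-<
    (λ c → χ-mono (c <? a) (c <? b) (λ c<a → <ᶜ-trans c<a a<b)) a
    (subst₂ _<_ (sym (χ-no (a <? a) (<ᶜ-irrefl refl))) (sym (χ-yes (a <? b) a<b)) (s≤s z≤n))

  rank-injective : ∀ {a b} → rank a ≡ rank b → a ≡ b
  rank-injective {a} {b} ra≡rb with compare a b
  ... | tri< a<b _ _  = ⊥-elim (<-irrefl ra≡rb (rank-mono a<b))
  ... | tri≈ _ a≡b _  = a≡b
  ... | tri> _ _ b<a  = ⊥-elim (<-irrefl (sym ra≡rb) (rank-mono b<a))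

  -- every position below k is the rank of some element (pigeonhole on
  -- the injective map Fin k → Fin k, i ↦ rank (from i))
  rank-surjective : ∀ j → j < k → ∃ λ c → rank c ≡ j
  rank-surjective j j<k = from i , (begin
    rank (from i)                  ≡⟨ Fin.toℕ-fromℕ< (rank<k (from i)) ⟨
    toℕ (rank-of-index i)          ≡⟨ cong toℕ hit ⟩
    toℕ (fromℕ< j<k)               ≡⟨ Fin.toℕ-fromℕ< j<k ⟩
    j                              ∎)
    where
    open ≡-Reasoning
    open Inverse enum using (to; from; strictlyInverseˡ)
    rank-of-index : Fin k → Fin k
    rank-of-index i = fromℕ< (rank<k (from i))
    rank-of-index-injective : ∀ {x y} → rank-of-index x ≡ rank-of-index y → x ≡ y
    rank-of-index-injective {x} {y} eq = begin
      x                ≡⟨ strictlyInverseˡ x ⟨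
      to (from x)      ≡⟨ cong to (rank-injective (Fin.fromℕ<-injective _ _ (rank<k (from x)) (rank<k (from y)) eq)) ⟩
      to (from y)      ≡⟨ strictlyInverseˡ y ⟩
      y                ∎
    preimage : ∃ λ i → rank-of-index i ≡ fromℕ< j<k
    preimage = Fin-injective⇒surjective rank-of-index rank-of-index-injective (fromℕ< j<k)
    i : Fin k
    i = proj₁ preimage
    hit : rank-of-index i ≡ fromℕ< j<k
    hit = proj₂ preimage

module IntervalArithmetic (n m : ℕ.ℕ) where
  open import Data.Integer.Base
    using (ℤ; +_; -_; pred; -1ℤ; 0ℤ; _+_; _-_; _⊔_; _⊓_; _≤_; _<_; ∣_∣; +≤+; +<+)
  open import Data.Integer using (_≤?_; _<?_)
  open import Data.Integer.Properties
  open import Data.Integer.Tactic.RingSolver using (solve-∀)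
  open Model n m

  reflect-min : ∀ M x y → M - (x ⊓ (M - y)) ≡ (M - x) ⊔ y
  reflect-min M x y = begin
    M - (x ⊓ (M - y))       ≡⟨ cong (λ t → M + t) (neg-distrib-⊓-⊔ x (M - y)) ⟩
    M + (- x ⊔ - (M - y))   ≡⟨ mono-≤-distrib-⊔ {f = λ t → M + t} (+-monoʳ-≤ M) (- x) (- (M - y)) ⟩
    (M - x) ⊔ (M - (M - y)) ≡⟨ cong ((M - x) ⊔_) (cancel M y) ⟩
    (M - x) ⊔ y             ∎
    where
    open ≡-Reasoning
    cancel : ∀ M y → M - (M - y) ≡ y
    cancel = solve-∀

  star-reflects : ∀ j → j ℕ.≤ m → star (+ j) ≡ + m - + j
  star-reflects ℕ.zero    _     = sym (+-identityʳ (+ m))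
  star-reflects (ℕ.suc j) 1+j≤m = begin
    p (star (+ j))       ≡⟨ cong p (star-reflects j (ℕ.<⇒≤ 1+j≤m)) ⟩
    p (+ m - + j)        ≡⟨ p-above-bottom ⟩
    -1ℤ + (+ m - + j)    ≡⟨ shift (+ m) (+ j) ⟩
    + m - (+ 1 + + j)    ∎
    where
    open ≡-Reasoning
    m-j≡m∸j : + m - + j ≡ + (m ℕ.∸ j)
    m-j≡m∸j = trans (m-n≡m⊖n m j) (⊖-≥ (ℕ.<⇒≤ 1+j≤m))
    above : - (+ n) < + m - + j
    above = subst (- (+ n) <_) (sym m-j≡m∸j)
                  (≤-<-trans (neg-≤-pos {n} {0}) (+<+ (ℕ.m<n⇒0<n∸m 1+j≤m)))
    p-above-bottom : p (+ m - + j) ≡ pred (+ m - + j)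
    p-above-bottom with - (+ n) <? + m - + j
    ... | yes _     = refl
    ... | no ¬above = ⊥-elim (¬above above)
    shift : ∀ M J → -1ℤ + (M - J) ≡ M - (+ 1 + J)
    shift = solve-∀

  star-nonneg : ∀ {x} → 0ℤ ≤ x → x ≤ + m → star x ≡ + m - x
  star-nonneg {+ j} _ (+≤+ j≤m) = star-reflects j j≤m

  -- the negation x' = x ⇒ 0 of the model: negatives are fixed, [0,m] is reflected
  neg : ℤ → ℤ
  neg x with 0ℤ ≤? x
  ... | yes _ = + m - x
  ... | no  _ = x

  neg-nonneg : ∀ {x} → 0ℤ ≤ x → neg x ≡ + m - x
  neg-nonneg {x} 0≤x with 0ℤ ≤? x
  ... | yes _  = refl
  ... | no 0≰x = ⊥-elim (0≰x 0≤x)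

  neg-negative : ∀ {x} → ¬ (0ℤ ≤ x) → neg x ≡ x
  neg-negative {x} 0≰x with 0ℤ ≤? x
  ... | yes 0≤x = ⊥-elim (0≰x 0≤x)
  ... | no  _   = refl

  imp-nonneg : ∀ {x y} → 0ℤ ≤ x → 0ℤ ≤ y → imp x y ≡ star x ⊔ y
  imp-nonneg {x} {y} 0≤x 0≤y with 0ℤ ≤? x | 0ℤ ≤? y
  ... | yes _   | yes _  = refl
  ... | yes _   | no 0≰y = ⊥-elim (0≰y 0≤y)
  ... | no 0≰x  | _      = ⊥-elim (0≰x 0≤x)

  imp-negative-left : ∀ {x} y → ¬ (0ℤ ≤ x) → imp x y ≡ x ⊓ y
  imp-negative-left {x} y 0≰x with 0ℤ ≤? x | 0ℤ ≤? y
  ... | yes 0≤x | _     = ⊥-elim (0≰x 0≤x)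
  ... | no _    | yes _ = refl
  ... | no _    | no _  = refl

  imp-negative-right : ∀ x {y} → ¬ (0ℤ ≤ y) → imp x y ≡ x ⊓ y
  imp-negative-right x {y} 0≰y with 0ℤ ≤? x | 0ℤ ≤? y
  ... | yes _ | yes 0≤y = ⊥-elim (0≰y 0≤y)
  ... | yes _ | no _    = refl
  ... | no _  | _       = refl

  negative-⊓ : ∀ {x z} → ¬ (0ℤ ≤ x) → 0ℤ ≤ z → x ⊓ z ≡ x
  negative-⊓ 0≰x 0≤z = i≤j⇒i⊓j≡i (≤-trans (<⇒≤ (≰⇒> 0≰x)) 0≤z)

  imp-via-neg : ∀ {x y} → x ≤ + m → y ≤ + m → imp x y ≡ neg (x ⊓ neg y)
  imp-via-neg {x} {y} x≤m y≤m = by-signs (0ℤ ≤? x) (0ℤ ≤? y)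
    where
    open ≡-Reasoning
    by-signs : Dec (0ℤ ≤ x) → Dec (0ℤ ≤ y) → imp x y ≡ neg (x ⊓ neg y)
    by-signs (yes 0≤x) (yes 0≤y) = begin
      imp x y                ≡⟨ imp-nonneg 0≤x 0≤y ⟩
      star x ⊔ y             ≡⟨ cong (_⊔ y) (star-nonneg 0≤x x≤m) ⟩
      (+ m - x) ⊔ y          ≡⟨ reflect-min (+ m) x y ⟨
      + m - (x ⊓ (+ m - y))  ≡⟨ neg-nonneg (⊓-glb 0≤x (i≤j⇒0≤j-i y≤m)) ⟨
      neg (x ⊓ (+ m - y))    ≡⟨ cong (λ t → neg (x ⊓ t)) (neg-nonneg 0≤y) ⟨
      neg (x ⊓ neg y)        ∎
    by-signs (yes 0≤x) (no 0≰y) = begin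
      imp x y          ≡⟨ imp-negative-right x 0≰y ⟩
      x ⊓ y            ≡⟨ x⊓y≡y ⟩
      y                ≡⟨ neg-negative 0≰y ⟨
      neg y            ≡⟨ cong neg x⊓y≡y ⟨
      neg (x ⊓ y)      ≡⟨ cong (λ t → neg (x ⊓ t)) (neg-negative 0≰y) ⟨
      neg (x ⊓ neg y)  ∎
      where
      x⊓y≡y : x ⊓ y ≡ y
      x⊓y≡y = trans (⊓-comm x y) (negative-⊓ 0≰y 0≤x)
    by-signs (no 0≰x) (yes 0≤y) = begin
      imp x y          ≡⟨ imp-negative-left y 0≰x ⟩
      x ⊓ y            ≡⟨ negative-⊓ 0≰x 0≤y ⟩
      x                ≡⟨ negative-⊓ 0≰x 0≤neg-y ⟨
      x ⊓ neg y        ≡⟨ neg-negative (λ 0≤x⊓ → 0≰x (≤-trans 0≤x⊓ (i⊓j≤i x (neg y)))) ⟨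
      neg (x ⊓ neg y)  ∎
      where
      0≤neg-y : 0ℤ ≤ neg y
      0≤neg-y = subst (0ℤ ≤_) (sym (neg-nonneg 0≤y)) (i≤j⇒0≤j-i y≤m)
    by-signs (no 0≰x) (no 0≰y) = begin
      imp x y          ≡⟨ imp-negative-left y 0≰x ⟩
      x ⊓ y            ≡⟨ cong (x ⊓_) (neg-negative 0≰y) ⟨
      x ⊓ neg y        ≡⟨ neg-negative (λ 0≤x⊓ → 0≰x (≤-trans 0≤x⊓ (i⊓j≤i x (neg y)))) ⟨
      neg (x ⊓ neg y)  ∎

  Elt-≡ : ∀ {x y : Elt} → val x ≡ val y → x ≡ y
  Elt-≡ {⟨ _ , lo₁ , hi₁ ⟩} {⟨ _ , lo₂ , hi₂ ⟩} refl
    rewrite ≤-irrelevant lo₁ lo₂ | ≤-irrelevant hi₁ hi₂ = refl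

  at : (r : ℕ.ℕ) → r ℕ.≤ n ℕ.+ m → Elt
  at r r≤n+m = ⟨ + r - + n , lower , upper ⟩
    where
    lower : - (+ n) ≤ + r - + n
    lower = subst (_≤ + r - + n) (+-identityˡ (- (+ n))) (+-monoˡ-≤ (- (+ n)) (+≤+ ℕ.z≤n))
    upper : + r - + n ≤ + m
    upper = subst (+ r - + n ≤_) (cancel (+ n) (+ m))
                  (+-monoˡ-≤ (- (+ n)) (subst (+ r ≤_) (pos-+ n m) (+≤+ r≤n+m)))
      where
      cancel : ∀ N M → (N + M) - N ≡ M
      cancel = solve-∀

  position : Elt → ℕ.ℕ
  position x = ∣ val x + + n ∣

  +position : ∀ x → + position x ≡ val x + + n
  +position x = 0≤i⇒+∣i∣≡i (subst (_≤ val x + + n) (+-inverseˡ (+ n)) (+-monoˡ-≤ (+ n) (lo x)))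

  value-position : ∀ x → + position x - + n ≡ val x
  value-position x = trans (cong (_- + n) (+position x)) (cancel (val x) (+ n))
    where
    cancel : ∀ V N → (V + N) - N ≡ V
    cancel = solve-∀

  position-at : ∀ r r≤n+m → position (at r r≤n+m) ≡ r
  position-at r _ = cong ∣_∣ (cancel (+ r) (+ n))
    where
    cancel : ∀ R N → (R - N) + N ≡ R
    cancel = solve-∀

  position-bound : ∀ x → position x ℕ.≤ n ℕ.+ m
  position-bound x = drop‿+≤+ (begin
    + position x   ≡⟨ +position x ⟩
    val x + + n    ≤⟨ +-monoˡ-≤ (+ n) (hi x) ⟩
    + m + + n      ≡⟨ pos-+ m n ⟨
    + (m ℕ.+ n)    ≡⟨ cong +_ (ℕ.+-comm m n) ⟩
    + (n ℕ.+ m)    ∎)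
    where open ≤-Reasoning

  reflect-position : ∀ {r c} → r ℕ.+ c ≡ n ℕ.+ m → + (n ℕ.+ c) - + n ≡ + m - (+ r - + n)
  reflect-position {r} {c} r+c≡n+m = begin
    + (n ℕ.+ c) - + n      ≡⟨ cong (_- + n) (pos-+ n c) ⟩
    (+ n + + c) - + n      ≡⟨ shift-invariant (+ n) (+ c) (+ r) ⟩
    (+ r + + c) - + r      ≡⟨ cong (_- + r) (trans (sym (pos-+ r c)) (trans (cong +_ r+c≡n+m) (pos-+ n m))) ⟩
    (+ n + + m) - + r      ≡⟨ regroup (+ n) (+ m) (+ r) ⟩
    + m - (+ r - + n)      ∎
    where
    open ≡-Reasoning
    shift-invariant : ∀ N C R → (N + C) - N ≡ (R + C) - R
    shift-invariant = solve-∀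
    regroup : ∀ N M R → (N + M) - R ≡ M - (R - N)
    regroup = solve-∀

module FiniteChain (A : Zroupoid) (chain : IsI20Chain A)
                   (k : ℕ.ℕ) (enum : Zroupoid.Carrier A ↔ Fin k) where
  open import Data.Integer.Base using (ℤ; +_; -_; 0ℤ; _-_; _⊓_; _≤_; +≤+)
  open import Data.Integer.Properties
    using (+-monoˡ-≤; i≤j⇒0≤j-i; 0≤i-j⇒j≤i; i≤j⇒i⊓j≡i; i≥j⇒i⊓j≡j; +-inverseʳ; drop‿+≤+)
  open Zroupoid A
  open ChainAlgebra A chain
  open Counting using (χ; χ-⊎)
  open Counting.Totals enum using (total; total-cong; total-+; total-involution)
  open Inverse enum using (to; from; strictlyInverseʳ)
  open ≡-Reasoning

  _≟_ : DecidableEquality Carrier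
  x ≟ y with to x Fin.≟ to y
  ... | yes tx≡ty = yes (trans (sym (strictlyInverseʳ x)) (trans (cong from tx≡ty) (strictlyInverseʳ y)))
  ... | no  tx≢ty = no (tx≢ty ∘ cong to)

  open NonStrictToStrict _≡_ _⊑_ using () renaming (_<_ to _⊏_)

  ⊏-isStrictTotalOrder : IsStrictTotalOrder _≡_ _⊏_
  ⊏-isStrictTotalOrder = NonStrictToStrict.<-isStrictTotalOrder₁ _≡_ _⊑_ _≟_ ⊑-isTotalOrder

  open IsStrictTotalOrder ⊏-isStrictTotalOrder using (compare) renaming (_<?_ to _⊏?_)
  open Rank enum ⊏-isStrictTotalOrder

  n₀ m₀ : ℕ.ℕ
  n₀ = rank 𝟎
  m₀ = corank 𝟎

  k≡n₀+1+m₀ : n₀ ℕ.+ ℕ.suc m₀ ≡ k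
  k≡n₀+1+m₀ = rank+corank 𝟎

  rank+corank≡n₀+m₀ : ∀ a → rank a ℕ.+ corank a ≡ n₀ ℕ.+ m₀
  rank+corank≡n₀+m₀ a = ℕ.suc-injective (begin
    ℕ.suc (rank a ℕ.+ corank a)  ≡⟨ ℕ.+-suc (rank a) (corank a) ⟨
    rank a ℕ.+ ℕ.suc (corank a)  ≡⟨ trans (rank+corank a) (sym k≡n₀+1+m₀) ⟩
    n₀ ℕ.+ ℕ.suc m₀              ≡⟨ ℕ.+-suc n₀ m₀ ⟩
    ℕ.suc (n₀ ℕ.+ m₀)            ∎)

  rank≤n₀+m₀ : ∀ a → rank a ℕ.≤ n₀ ℕ.+ m₀
  rank≤n₀+m₀ a = subst (rank a ℕ.≤_) (rank+corank≡n₀+m₀ a) (ℕ.m≤m+n (rank a) (corank a))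

  below-k : ∀ {j} → j ℕ.≤ n₀ ℕ.+ m₀ → j ℕ.< k
  below-k j≤n₀+m₀ = subst (_ ℕ.<_) (trans (sym (ℕ.+-suc n₀ m₀)) k≡n₀+1+m₀) (ℕ.s≤s j≤n₀+m₀)

  rank-mono-⊑ : ∀ {a b} → a ⊑ b → rank a ℕ.≤ rank b
  rank-mono-⊑ {a} {b} a⊑b with a ≟ b
  ... | yes refl = ℕ.≤-refl
  ... | no  a≢b  = ℕ.<⇒≤ (rank-mono (a⊑b , a≢b))

  sign : ∀ a → a ⊏ 𝟎 ⊎ 𝟎 ⊑ a
  sign a with compare a 𝟎
  ... | tri< a⊏𝟎 _ _  = inj₁ a⊏𝟎
  ... | tri≈ _ refl _ = inj₂ (∧-idem 𝟎)
  ... | tri> _ _ 𝟎⊏a  = inj₂ (proj₁ 𝟎⊏a)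

  negative-fixed : ∀ {a} → a ⊏ 𝟎 → a ′ ≡ a
  negative-fixed (a⊑𝟎 , a≢𝟎) with below-𝟎 a⊑𝟎
  ... | inj₁ a′≡a = a′≡a
  ... | inj₂ a≡𝟎  = ⊥-elim (a≢𝟎 a≡𝟎)

  module _ {a : Carrier} (𝟎⊑a : 𝟎 ⊑ a) where

    ′-⊏-from-negative : ∀ {c} → c ⊏ 𝟎 → (c ′) ⊏ (a ′)
    ′-⊏-from-negative {c} (c⊑𝟎 , c≢𝟎) = subst (_⊏ (a ′)) (sym (negative-fixed (c⊑𝟎 , c≢𝟎)))
      ( ⊑-trans c⊑𝟎 (𝟎⊑-′ 𝟎⊑a)
      , λ c≡a′ → c≢𝟎 (⊑-antisym c⊑𝟎 (subst (𝟎 ⊑_) (sym c≡a′) (𝟎⊑-′ 𝟎⊑a))) )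

    ′-⊏-from-above : ∀ {c} → a ⊏ c → (c ′) ⊏ (a ′)
    ′-⊏-from-above (a⊑c , a≢c) = ′-antitone 𝟎⊑a a⊑c , λ c′≡a′ → a≢c (sym (′-injective c′≡a′))

    ′-⊏-cases : ∀ {c} → (c ′) ⊏ (a ′) → c ⊏ 𝟎 ⊎ a ⊏ c
    ′-⊏-cases {c} (c′⊑a′ , c′≢a′) with sign c
    ... | inj₁ c⊏𝟎 = inj₁ c⊏𝟎
    ... | inj₂ 𝟎⊑c with compare a c
    ...   | tri< a⊏c _ _  = inj₂ a⊏c
    ...   | tri≈ _ refl _ = ⊥-elim (c′≢a′ refl)
    ...   | tri> _ _ c⊏a  = ⊥-elim (c′≢a′ (⊑-antisym c′⊑a′ (′-antitone 𝟎⊑c (proj₁ c⊏a))))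

    negative-not-above : ∀ {c} → c ⊏ 𝟎 → ¬ (a ⊏ c)
    negative-not-above (c⊑𝟎 , _) (a⊑c , a≢c) = a≢c (⊑-antisym a⊑c (⊑-trans c⊑𝟎 𝟎⊑a))

    rank-′ : rank (a ′) ≡ n₀ ℕ.+ corank a
    rank-′ = begin
      rank (a ′)
        ≡⟨ total-involution _′ ′-involutive (λ c → χ (c ⊏? (a ′))) ⟨
      total (λ c → χ ((c ′) ⊏? (a ′)))
        ≡⟨ total-cong (λ c → χ-⊎ ((c ′) ⊏? (a ′)) (c ⊏? 𝟎) (a ⊏? c)
             ′-⊏-cases [ ′-⊏-from-negative , ′-⊏-from-above ] negative-not-above) ⟩
      total (λ c → χ (c ⊏? 𝟎) ℕ.+ χ (a ⊏? c))
        ≡⟨ total-+ (λ c → χ (c ⊏? 𝟎)) (λ c → χ (a ⊏? c)) ⟩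
      n₀ ℕ.+ corank a ∎

  open IntervalArithmetic n₀ m₀
  open Model n₀ m₀ using (Elt; val; hi; imp)

  toElt : Carrier → Elt
  toElt a = at (rank a) (rank≤n₀+m₀ a)

  -- the value of a is rank a - n₀, so that 𝟎 has value 0
  value : Carrier → ℤ
  value a = val (toElt a)

  value-mono : ∀ {a b} → a ⊑ b → value a ≤ value b
  value-mono a⊑b = +-monoˡ-≤ (- (+ n₀)) (+≤+ (rank-mono-⊑ a⊑b))

  value-nonneg : ∀ {a} → 𝟎 ⊑ a → 0ℤ ≤ value a
  value-nonneg 𝟎⊑a = i≤j⇒0≤j-i (+≤+ (rank-mono-⊑ 𝟎⊑a))

  value-negative : ∀ {a} → a ⊏ 𝟎 → ¬ (0ℤ ≤ value a)
  value-negative a⊏𝟎 0≤value = ℕ.<⇒≱ (rank-mono a⊏𝟎) (drop‿+≤+ (0≤i-j⇒j≤i 0≤value))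

  value-∧ : ∀ a b → value (a ∧ b) ≡ value a ⊓ value b
  value-∧ a b with ⊑-total a b
  ... | inj₁ a⊑b = trans (cong value a⊑b) (sym (i≤j⇒i⊓j≡i (value-mono a⊑b)))
  ... | inj₂ b⊑a = trans (cong value (trans (∧-comm a b) b⊑a)) (sym (i≥j⇒i⊓j≡j (value-mono b⊑a)))

  value-′ : ∀ a → value (a ′) ≡ neg (value a)
  value-′ a with sign a
  ... | inj₁ a⊏𝟎 = trans (cong value (negative-fixed a⊏𝟎)) (sym (neg-negative (value-negative a⊏𝟎)))
  ... | inj₂ 𝟎⊑a = begin
    + rank (a ′) - + n₀          ≡⟨ cong (λ r → + r - + n₀) (rank-′ 𝟎⊑a) ⟩
    + (n₀ ℕ.+ corank a) - + n₀   ≡⟨ reflect-position (rank+corank≡n₀+m₀ a) ⟩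
    + m₀ - value a               ≡⟨ neg-nonneg (value-nonneg 𝟎⊑a) ⟨
    neg (value a)                ∎

  value-⇒ : ∀ a b → value (a ⇒ b) ≡ imp (value a) (value b)
  value-⇒ a b = begin
    value (a ⇒ b)                  ≡⟨ cong value (⇒-via-∧ a b) ⟩
    value ((a ∧ b ′) ′)            ≡⟨ value-′ (a ∧ b ′) ⟩
    neg (value (a ∧ b ′))          ≡⟨ cong neg (value-∧ a (b ′)) ⟩
    neg (value a ⊓ value (b ′))    ≡⟨ cong (λ t → neg (value a ⊓ t)) (value-′ b) ⟩
    neg (value a ⊓ neg (value b))  ≡⟨ imp-via-neg (hi (toElt a)) (hi (toElt b)) ⟨
    imp (value a) (value b)        ∎

  fromElt : Elt → Carrier
  fromElt x = proj₁ (rank-surjective (position x) (below-k (position-bound x)))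

  rank-fromElt : ∀ x → rank (fromElt x) ≡ position x
  rank-fromElt x = proj₂ (rank-surjective (position x) (below-k (position-bound x)))

  isomorphism : A ≅ Interval n₀ m₀
  isomorphism = record
    { to      = toElt
    ; from    = fromElt
    ; from∘to = λ a → rank-injective (trans (rank-fromElt (toElt a)) (position-at (rank a) (rank≤n₀+m₀ a)))
    ; to∘from = λ x → Elt-≡ (trans (cong (λ r → + r - + n₀) (rank-fromElt x)) (value-position x))
    ; to-⇒    = λ a b → Elt-≡ (value-⇒ a b)
    ; to-𝟎    = Elt-≡ (+-inverseʳ (+ n₀))
    }

open import Data.Nat using (ℕ; _+_; _∸_; _≤_)
open import Data.Nat.Properties using (m≤m+n; m≤n+m; +-assoc; +-comm; +-suc)

theorem5p13 : (A : Zroupoid) → IsI20Chain A →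
    (k : ℕ) → Zroupoid.Carrier A ↔ Fin k →
    Σ[ n ∈ ℕ ] Σ[ m ∈ ℕ ]
      (n ≤ k ∸ 1) × (m ≤ k ∸ 1) × (n + m + 1 ≡ k) × (A ≅ Interval n m)
theorem5p13 A chain k enum =
  n₀ , m₀ , subst (n₀ ≤_) n₀+m₀≡k∸1 (m≤m+n n₀ m₀) , subst (m₀ ≤_) n₀+m₀≡k∸1 (m≤n+m m₀ n₀)
  , n₀+m₀+1≡k , isomorphism
  where
  open FiniteChain A chain k enum using (n₀; m₀; k≡n₀+1+m₀; isomorphism)
  n₀+m₀≡k∸1 : n₀ + m₀ ≡ k ∸ 1
  n₀+m₀≡k∸1 = cong (_∸ 1) (trans (sym (+-suc n₀ m₀)) k≡n₀+1+m₀)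
  n₀+m₀+1≡k : n₀ + m₀ + 1 ≡ k
  n₀+m₀+1≡k = trans (+-assoc n₀ m₀ 1) (trans (cong (n₀ +_) (+-comm m₀ 1)) k≡n₀+1+m₀)
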